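{- Let $G$ be a nice graph and let $V_4$ be the set of vertices of degree at least $4$ in $G$. Then $\mathsf{high}(G)\le 8\cdot\mathsf{sen}(G)$, where $\mathsf{high}(G)=\sum_{v\in V_4}\deg_G(v)$.
   Context: All graphs are finite, simple and undirected; subcubic means maximum degree at most $3$. $\mathsf{sen}(G)$ is the minimum number of edges whose deletion makes $G$ subcubic. A cycle $C$ in $G$ is a pan cycle if exactly one vertex of $C$ has degree $3$ in $G$ and all others have degree $2$ in $G$; it is a bull cycle if exactly two vertices of $C$ have degree $3$ in $G$ and all others have degree $2$ in $G$. A graph is nice if it is connected, not subcubic, has no pan cycles, and every bull cycle in it has length $3$. -}

module Defs where

open import Data.Nat using (ℕ; zero; suc; _+_; _*_; _≤_; _<_; _≤ᵇ_; _<ᵇ_; _≡ᵇ_)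
open import Data.Bool using (Bool; true; false; if_then_else_; _∧_; not)
open import Data.Fin using (Fin; zero; suc; toℕ; inject₁; fromℕ)
open import Data.List using (List; map; allFin)
open import Data.Nat.ListAction using (sum)
open import Data.Product using (Σ; ∃; _×_)
open import Data.Sum using (_⊎_)
open import Relation.Nullary using (¬_)
open import Relation.Binary.PropositionalEquality using (_≡_)
open import Function.Definitions using (Injective)

count : {m : ℕ} → (Fin m → Bool) → ℕ
count {m} p = sum (map (λ i → if p i then 1 else 0) (allFin m))

record Graph (n : ℕ) : Set where
  field
    adj    : Fin n → Fin n → Bool
    sym    : ∀ i j → adj i j ≡ adj j i
    irrefl : ∀ i → adj i i ≡ false
open Graph public

deg : {n : ℕ} → Graph n → Fin n → ℕ
deg G v = count (adj G v)

Subcubic : {n : ℕ} → Graph n → Set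
Subcubic G = ∀ v → deg G v ≤ 3

data Walk {n : ℕ} (G : Graph n) : Fin n → Fin n → Set where
  here : ∀ {u} → Walk G u u
  step : ∀ {u w v} → adj G u w ≡ true → Walk G w v → Walk G u v

Connected : {n : ℕ} → Graph n → Set
Connected {n} G = ∀ (u v : Fin n) → Walk G u v

-- a cycle of length 3 + k: distinct vertices f 0, …, f (2+k), consecutive ones adjacent,
-- and f (2+k) adjacent to f 0
record Cycle {n : ℕ} (G : Graph n) : Set where
  field
    k     : ℕ
    vtx   : Fin (3 + k) → Fin n
    inj   : Injective _≡_ _≡_ vtx
    edges : ∀ (i : Fin (2 + k)) → adj G (vtx (inject₁ i)) (vtx (suc i)) ≡ true
    close : adj G (vtx (fromℕ (2 + k))) (vtx zero) ≡ true
open Cycle public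

cycleLength : {n : ℕ} {G : Graph n} → Cycle G → ℕ
cycleLength C = 3 + k C

deg3Count : {n : ℕ} {G : Graph n} → Cycle G → ℕ
deg3Count {G = G} C = count (λ i → deg G (vtx C i) ≡ᵇ 3)

Deg23 : {n : ℕ} {G : Graph n} → Cycle G → Set
Deg23 {G = G} C = ∀ i → (deg G (vtx C i) ≡ 2) ⊎ (deg G (vtx C i) ≡ 3)

PanCycle : {n : ℕ} {G : Graph n} → Cycle G → Set
PanCycle C = deg3Count C ≡ 1 × Deg23 C

BullCycle : {n : ℕ} {G : Graph n} → Cycle G → Set
BullCycle C = deg3Count C ≡ 2 × Deg23 C

Nice : {n : ℕ} → Graph n → Set
Nice G = Connected G × ¬ Subcubic G
       × (∀ (C : Cycle G) → ¬ PanCycle C)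
       × (∀ (C : Cycle G) → BullCycle C → cycleLength C ≡ 3)

_⊆G_ : {n : ℕ} → Graph n → Graph n → Set
H ⊆G G = ∀ i j → adj H i j ≡ true → adj G i j ≡ true

-- number of edges of G not in H (each unordered pair {i,j}, i < j, counted once)
deleted : {n : ℕ} → Graph n → Graph n → ℕ
deleted G H = sum (map (λ i → count (λ j → (toℕ i <ᵇ toℕ j) ∧ adj G i j ∧ not (adj H i j))) (allFin _))

IsSen : {n : ℕ} → Graph n → ℕ → Set
IsSen {n} G s =
  (Σ (Graph n) λ H → H ⊆G G × Subcubic H × deleted G H ≡ s)
  × (∀ (H : Graph n) → H ⊆G G → Subcubic H → s ≤ deleted G H)

high : {n : ℕ} → Graph n → ℕ
high G = sum (map (λ v → if 4 ≤ᵇ deg G v then deg G v else 0) (allFin _))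

-- A vertex of degree d ≥ 4 keeps at most 3 of its edges in a subcubic spanning
-- subgraph, so it loses e ≥ d − 3 ≥ 1 of them and d ≤ 3 + e ≤ 4e. Summing over
-- all vertices counts every deleted edge twice, whence high(G) ≤ 4 · 2 · sen(G).
module Submission where

open import Defs hiding (sym)
open import Data.Nat using (ℕ; zero; suc; _+_; _*_; _≤_; _<_; _≤ᵇ_; _<ᵇ_; z≤n)
open import Data.Nat.Properties
open import Data.Bool using (Bool; true; false; if_then_else_; _∧_; not)
open import Data.Bool.Properties using (T-≡)
open import Data.Fin using (Fin; zero; suc; toℕ)
open import Data.Fin.Properties using (toℕ-injective)
open import Data.List using (map; allFin; tabulate)
open import Data.List.Properties using (map-tabulate)
open import Data.Nat.ListAction using (sum)
open import Data.Product using (_,_)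
open import Function using (_∘_; id; Equivalence)
open import Relation.Binary using (tri<; tri≈; tri>)
open import Relation.Binary.PropositionalEquality
  using (_≡_; refl; sym; trans; cong; cong₂; module ≡-Reasoning)
open import Relation.Nullary using (contradiction)
open import Algebra.Properties.Semiring.Sum +-*-semiring
  using (sum-syntax; sum-cong-≗; ∑-distrib-+; ∑-comm; *-distribˡ-sum)
  renaming (sum to ∑)

private
  variable
    n : ℕ

sum-tabulate : (f : Fin n → ℕ) → sum (tabulate f) ≡ ∑ f
sum-tabulate {zero}  f = refl
sum-tabulate {suc n} f = cong (f zero +_) (sum-tabulate (f ∘ suc))

sum-map-allFin : (f : Fin n → ℕ) → sum (map f (allFin n)) ≡ ∑ f
sum-map-allFin f = trans (cong sum (map-tabulate id f)) (sum-tabulate f)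

∑-mono-≤ : {f g : Fin n → ℕ} → (∀ i → f i ≤ g i) → ∑ f ≤ ∑ g
∑-mono-≤ {zero}  f≤g = z≤n
∑-mono-≤ {suc n} f≤g = +-mono-≤ (f≤g zero) (∑-mono-≤ (f≤g ∘ suc))

indicator : Bool → ℕ
indicator b = if b then 1 else 0

count≡∑ : (p : Fin n → Bool) → count p ≡ ∑[ i < n ] indicator (p i)
count≡∑ p = sum-map-allFin (indicator ∘ p)

<ᵇ-true : ∀ {m k} → m < k → (m <ᵇ k) ≡ true
<ᵇ-true m<k = Equivalence.to T-≡ (<⇒<ᵇ m<k)

<ᵇ-false : ∀ {m k} → k ≤ m → (m <ᵇ k) ≡ false
<ᵇ-false {m} {k} k≤m with m <ᵇ k in eq
... | false = refl
... | true  = contradiction (<ᵇ⇒< m k (Equivalence.from T-≡ eq)) (≤⇒≯ k≤m)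

module Handshake (R : Fin n → Fin n → Bool)
                 (R-sym : ∀ i j → R i j ≡ R j i) (R-irrefl : ∀ i → R i i ≡ false) where

  upper : Fin n → Fin n → ℕ
  upper i j = indicator ((toℕ i <ᵇ toℕ j) ∧ R i j)

  indicator≡upper+upperᵀ : ∀ i j → indicator (R i j) ≡ upper i j + upper j i
  indicator≡upper+upperᵀ i j with <-cmp (toℕ i) (toℕ j)
  ... | tri< i<j _ _ rewrite <ᵇ-true i<j | <ᵇ-false (<⇒≤ i<j) = sym (+-identityʳ _)
  ... | tri> _ _ j<i rewrite <ᵇ-true j<i | <ᵇ-false (<⇒≤ j<i) | R-sym i j = refl
  ... | tri≈ _ i≡j _ rewrite toℕ-injective i≡j | R-irrefl j | <ᵇ-false (≤-refl {toℕ j}) = refl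

  upperCount : Fin n → ℕ
  upperCount i = count (λ j → (toℕ i <ᵇ toℕ j) ∧ R i j)

  handshake : ∑[ i < n ] count (R i) ≡ 2 * ∑ upperCount
  handshake = begin
    ∑[ i < n ] count (R i)                           ≡⟨ sum-cong-≗ (count≡∑ ∘ R) ⟩
    ∑[ i < n ] ∑[ j < n ] indicator (R i j)          ≡⟨ sum-cong-≗ (sum-cong-≗ ∘ indicator≡upper+upperᵀ) ⟩
    ∑[ i < n ] ∑[ j < n ] (upper i j + upper j i)    ≡⟨ sum-cong-≗ (λ i → ∑-distrib-+ (upper i) (λ j → upper j i)) ⟩
    ∑[ i < n ] (∑ (upper i) + ∑[ j < n ] upper j i)  ≡⟨ ∑-distrib-+ (∑ ∘ upper) (λ i → ∑[ j < n ] upper j i) ⟩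
    U + ∑[ i < n ] ∑[ j < n ] upper j i              ≡⟨ cong (U +_) (∑-comm (λ i j → upper j i)) ⟩
    U + U                                            ≡⟨ cong (U +_) (sym (+-identityʳ U)) ⟩
    2 * U                                            ≡⟨ cong (2 *_) (sum-cong-≗ (λ i → sym (count≡∑ (λ j → (toℕ i <ᵇ toℕ j) ∧ R i j)))) ⟩
    2 * ∑ upperCount                                 ∎
    where
      open ≡-Reasoning
      U = ∑[ i < n ] ∑ (upper i)

m+n≤4*n : ∀ {m n} → m ≤ 3 → 4 ≤ m + n → m + n ≤ 4 * n
m+n≤4*n {m} {zero}  m≤3 4≤m+0 = contradiction (≤-trans 4≤m+0 (≤-trans (≤-reflexive (+-identityʳ m)) m≤3)) 1+n≰n
m+n≤4*n {m} {suc n} m≤3 _     = begin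
  m + suc n          ≤⟨ +-monoˡ-≤ (suc n) m≤3 ⟩
  3 + suc n          ≤⟨ +-monoˡ-≤ (suc n) (m≤m*n 3 (suc n)) ⟩
  3 * suc n + suc n  ≡⟨ +-comm (3 * suc n) (suc n) ⟩
  4 * suc n          ∎
  where open ≤-Reasoning

indicator-split : ∀ {a b} → (b ≡ true → a ≡ true) → indicator a ≡ indicator b + indicator (a ∧ not b)
indicator-split {true}  {true}  b⇒a = refl
indicator-split {true}  {false} b⇒a = refl
indicator-split {false} {true}  b⇒a = contradiction (b⇒a refl) λ ()
indicator-split {false} {false} b⇒a = refl

highPart : Graph n → Fin n → ℕ
highPart G v = if 4 ≤ᵇ deg G v then deg G v else 0

module Deletion (G H : Graph n) (H⊆G : H ⊆G G) where

  removed : Fin n → Fin n → Bool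
  removed i j = adj G i j ∧ not (adj H i j)

  lost : Fin n → ℕ
  lost v = count (removed v)

  deg≡deg+lost : ∀ v → deg G v ≡ deg H v + lost v
  deg≡deg+lost v = begin
    deg G v                                                       ≡⟨ count≡∑ (adj G v) ⟩
    ∑[ j < n ] indicator (adj G v j)                              ≡⟨ sum-cong-≗ (λ j → indicator-split (H⊆G v j)) ⟩
    ∑[ j < n ] (indicator (adj H v j) + indicator (removed v j))  ≡⟨ ∑-distrib-+ (indicator ∘ adj H v) (indicator ∘ removed v) ⟩
    ∑[ j < n ] indicator (adj H v j) + ∑[ j < n ] indicator (removed v j)
                                                                  ≡⟨ sym (cong₂ _+_ (count≡∑ (adj H v)) (count≡∑ (removed v))) ⟩
    deg H v + lost v                                              ∎
    where open ≡-Reasoning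

  removed-sym : ∀ i j → removed i j ≡ removed j i
  removed-sym i j rewrite Graph.sym G i j | Graph.sym H i j = refl

  removed-irrefl : ∀ i → removed i i ≡ false
  removed-irrefl i rewrite irrefl G i = refl

  ∑lost≡2*deleted : ∑ lost ≡ 2 * deleted G H
  ∑lost≡2*deleted = trans handshake (cong (2 *_) (sym (sum-map-allFin upperCount)))
    where open Handshake removed removed-sym removed-irrefl

  highPart≤4*lost : Subcubic H → ∀ v → highPart G v ≤ 4 * lost v
  highPart≤4*lost H-subcubic v with 4 ≤ᵇ deg G v in eq
  ... | false = z≤n
  ... | true  = begin
    deg G v           ≡⟨ deg≡deg+lost v ⟩
    deg H v + lost v  ≤⟨ m+n≤4*n (H-subcubic v) (≤-trans 4≤deg (≤-reflexive (deg≡deg+lost v))) ⟩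
    4 * lost v        ∎
    where
      open ≤-Reasoning
      4≤deg = ≤ᵇ⇒≤ 4 (deg G v) (Equivalence.from T-≡ eq)

  high≤8*deleted : Subcubic H → high G ≤ 8 * deleted G H
  high≤8*deleted H-subcubic = begin
    high G                   ≡⟨ sum-map-allFin (highPart G) ⟩
    ∑ (highPart G)           ≤⟨ ∑-mono-≤ (highPart≤4*lost H-subcubic) ⟩
    ∑[ v < n ] (4 * lost v)  ≡⟨ sym (*-distribˡ-sum 4 lost) ⟩
    4 * ∑ lost               ≡⟨ cong (4 *_) ∑lost≡2*deleted ⟩
    4 * (2 * deleted G H)    ≡⟨ sym (*-assoc 4 2 (deleted G H)) ⟩
    8 * deleted G H          ∎
    where open ≤-Reasoning

open Deletion using (high≤8*deleted)

lemma8 : ∀ (n : ℕ) (G : Graph n) → Nice G → ∀ (s : ℕ) → IsSen G s → high G ≤ 8 * s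
lemma8 n G _ s ((H , H⊆G , H-subcubic , refl) , _) = high≤8*deleted G H H⊆G H-subcubic
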